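{- For each $v \in \{67, 103, 109, 151\}$ there exists a propus difference family in the cyclic group $\mathbb{Z}_v$. More precisely, propus difference families exist in $\mathbb{Z}_{67}$ with each of the parameter sets $(67;33,28,28,31;53)$, $(67;30,31,31,27;52)$, $(67;30,30,30,28;51)$; in $\mathbb{Z}_{103}$ with parameter set $(103;48,51,51,42;89)$; in $\mathbb{Z}_{109}$ with parameter set $(109;52,49,49,48;89)$; and in $\mathbb{Z}_{151}$ with parameter set $(151;71,71,71,66;128)$.
   Context: Let $G=\mathbb{Z}_v$ (additive cyclic group). A difference family with parameter set $(v;k_1,k_2,k_3,k_4;\lambda)$ is a quadruple of subsets $X_1,X_2,X_3,X_4\subseteq \mathbb{Z}_v$ with $|X_i|=k_i$ such that every nonzero element $g\in\mathbb{Z}_v$ occurs exactly $\lambda$ times in the multiset $\{x-y : x,y\in X_i,\ x\neq y,\ i=1,\dots,4\}$. It is a Goethals–Seidel (GS) difference family if in addition $k_1+k_2+k_3+k_4=\lambda+v$. A subset $X\subseteq\mathbb{Z}_v$ is symmetric if $-X=X$. A propus difference family is a GS difference family $(X_1,X_2,X_3,X_4)$ such that (a) two of the blocks are equal, $X_i=X_j$ for some $i<j$, and (b) at least one of the remaining two blocks is symmetric. -}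

module Defs where

open import Data.Nat using (ℕ; _+_; _∸_; NonZero)
open import Data.Nat.DivMod using (_mod_)
open import Data.Bool using (Bool; true; false; _∧_; not; if_then_else_)
open import Data.Fin using (Fin; toℕ; _<_)
import Data.Fin as F
open import Data.Fin.Subset using (Subset; ∣_∣)
open import Data.Vec using (lookup; tabulate)
open import Data.List using (List; map; allFin)
open import Data.Nat.ListAction using (sum)
open import Data.Product using (Σ; _×_)
open import Data.Sum using (_⊎_)
open import Relation.Nullary using (¬_; isYes)
open import Relation.Binary.PropositionalEquality using (_≡_; _≢_)

-- Elements of ℤ_v are represented by Fin v (residues 0,…,v-1).

_⊖_ : {v : ℕ} .{{_ : NonZero v}} → Fin v → Fin v → Fin v
_⊖_ {v} x y = (toℕ x + (v ∸ toℕ y)) mod v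

⊝_ : {v : ℕ} .{{_ : NonZero v}} → Fin v → Fin v
⊝_ {v} x = (v ∸ toℕ x) mod v

_∈ᵇ_ : {v : ℕ} → Fin v → Subset v → Bool
x ∈ᵇ X = lookup X x

-- number of ordered pairs (x,y) with x,y ∈ X, x ≠ y, x - y = g,
-- i.e. the multiplicity of g in the multiset {x - y : x,y ∈ X, x ≠ y}
diffCount : {v : ℕ} .{{_ : NonZero v}} → Subset v → Fin v → ℕ
diffCount {v} X g =
  sum (map (λ x → sum (map (λ y →
    if (x ∈ᵇ X) ∧ (y ∈ᵇ X) ∧ not (isYes (x F.≟ y)) ∧ isYes ((x ⊖ y) F.≟ g)
    then 1 else 0) (allFin v))) (allFin v))

-- -X = { -x : x ∈ X } ; as a subset: z ∈ -X iff -z ∈ X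
negSet : {v : ℕ} .{{_ : NonZero v}} → Subset v → Subset v
negSet X = tabulate (λ z → lookup X (⊝ z))

Symmetric : {v : ℕ} .{{_ : NonZero v}} → Subset v → Set
Symmetric X = negSet X ≡ X

IsDifferenceFamily : (v : ℕ) .{{_ : NonZero v}} (k₁ k₂ k₃ k₄ lam : ℕ)
  (X₁ X₂ X₃ X₄ : Subset v) → Set
IsDifferenceFamily v k₁ k₂ k₃ k₄ lam X₁ X₂ X₃ X₄ =
  ∣ X₁ ∣ ≡ k₁ × ∣ X₂ ∣ ≡ k₂ × ∣ X₃ ∣ ≡ k₃ × ∣ X₄ ∣ ≡ k₄ ×
  ((g : Fin v) → ¬ (toℕ g ≡ 0) →
    diffCount X₁ g + diffCount X₂ g + diffCount X₃ g + diffCount X₄ g ≡ lam)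

IsGSDifferenceFamily : (v : ℕ) .{{_ : NonZero v}} (k₁ k₂ k₃ k₄ lam : ℕ)
  (X₁ X₂ X₃ X₄ : Subset v) → Set
IsGSDifferenceFamily v k₁ k₂ k₃ k₄ lam X₁ X₂ X₃ X₄ =
  IsDifferenceFamily v k₁ k₂ k₃ k₄ lam X₁ X₂ X₃ X₄ ×
  k₁ + k₂ + k₃ + k₄ ≡ lam + v

block : {v : ℕ} → Subset v → Subset v → Subset v → Subset v → Fin 4 → Subset v
block X₁ X₂ X₃ X₄ F.zero = X₁
block X₁ X₂ X₃ X₄ (F.suc F.zero) = X₂
block X₁ X₂ X₃ X₄ (F.suc (F.suc F.zero)) = X₃
block X₁ X₂ X₃ X₄ (F.suc (F.suc (F.suc F.zero))) = X₄

IsPropus : (v : ℕ) .{{_ : NonZero v}} (k₁ k₂ k₃ k₄ lam : ℕ)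
  (X₁ X₂ X₃ X₄ : Subset v) → Set
IsPropus v k₁ k₂ k₃ k₄ lam X₁ X₂ X₃ X₄ =
  IsGSDifferenceFamily v k₁ k₂ k₃ k₄ lam X₁ X₂ X₃ X₄ ×
  Σ (Fin 4) λ i → Σ (Fin 4) λ j → i < j × B i ≡ B j ×
    Σ (Fin 4) λ k → k ≢ i × k ≢ j × Symmetric (B k)
  where B = block X₁ X₂ X₃ X₄

PropusExists : (v : ℕ) .{{_ : NonZero v}} (k₁ k₂ k₃ k₄ lam : ℕ) → Set
PropusExists v k₁ k₂ k₃ k₄ lam =
  Σ (Subset v) λ X₁ → Σ (Subset v) λ X₂ → Σ (Subset v) λ X₃ → Σ (Subset v) λ X₄ →
    IsPropus v k₁ k₂ k₃ k₄ lam X₁ X₂ X₃ X₄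

module Submission where

-- Each of the six families has the shape (A, B, B, D) with A or D symmetric,
-- so once it is a Goethals–Seidel family it is propus by the choice of
-- indices (abbd-propus).  Block sizes, the GS condition and symmetry are
-- closed computations checked by refl.  The difference condition quantifies
-- over v² pairs per block, which is too slow to evaluate naively, so it is
-- verified through a faster but provably equal count:
--   1. In ℤ_v the equation x − y = g has the unique solution y = x − g.
--      Hence for g ≠ 0 the multiplicity of g in ΔX is |X ∩ (X + g)|
--      (diffCount≡overlapSize).
--   2. Writing X as its bit list L, |X ∩ (X + g)| is the number of common
--      ones of L and L rotated by v − g (overlapSize≡rotationCount).
--   3. The difference condition stated with rotation counts is decided by
--      all? over Fin v, and transfers to diffCount (by-evaluation).

open import Defs

open import Data.Bool using (Bool; false; _∧_; not; if_then_else_)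
open import Data.Bool.ListAction using (any)
open import Data.Bool.Properties using (∧-zeroʳ; ∧-identityʳ)
open import Data.Empty using (⊥-elim)
open import Data.Fin using (Fin; zero; suc; toℕ)
import Data.Fin as Fin
open import Data.Fin.Properties using (toℕ<n; toℕ-fromℕ<; toℕ-injective; all?)
open import Data.Fin.Subset using (Subset)
open import Data.List using (List; []; _∷_; _++_; length; drop; take; map; allFin)
import Data.List as List
open import Data.List.Properties using (map-cong; map-tabulate; length-drop)
open import Data.Nat
  using (ℕ; zero; suc; _+_; _∸_; _≤_; _<_; _<?_; _≟_; _≡ᵇ_; NonZero; z≤n; s≤s)
open import Data.Nat.DivMod using (_%_; %-distribˡ-+; m%n%n≡m%n; [m+n]%n≡m%n; m<n⇒m%n≡m; n%n≡0)
open import Data.Nat.ListAction using (sum)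
open import Data.Nat.Properties
  using (+-commutativeSemigroup; +-comm; +-assoc; +-identityʳ; <⇒≤; <-≤-trans;
         ≮⇒≥; +-monoˡ-<; +-cancelʳ-<; m+[n∸m]≡n; m∸n+n≡m; m∸n≤m)
open import Algebra.Properties.CommutativeSemigroup +-commutativeSemigroup
  using (x∙yz≈y∙xz; x∙yz≈z∙yx)
open import Data.Product using (Σ; _×_; _,_)
open import Data.Sum using (_⊎_; inj₁; inj₂)
open import Data.Vec using (Vec; lookup; toList)
import Data.Vec as Vec
open import Data.Vec.Properties using (length-toList)
open import Relation.Nullary using (¬_; Dec; yes; no; isYes)
open import Relation.Nullary.Decidable using (True; toWitness; ¬?; _→-dec_)
open import Relation.Binary.PropositionalEquality
  using (_≡_; _≢_; refl; sym; trans; cong; cong₂; subst; subst₂; module ≡-Reasoning)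
open ≡-Reasoning

𝟙 : Bool → ℕ
𝟙 b = if b then 1 else 0

∧-zeroʳ³ : ∀ a b c → a ∧ b ∧ c ∧ false ≡ false
∧-zeroʳ³ a b c = trans (cong (a ∧_) (trans (cong (b ∧_) (∧-zeroʳ c)) (∧-zeroʳ b))) (∧-zeroʳ a)

-- Writing a, b, c for toℕ x, toℕ y, toℕ g, the defining
-- fact is  x ⊖ y ≡ g  ⇔  (b + c) % v ≡ a;  its symmetry in y and g gives
-- uniqueness of solutions, which is all the counting argument needs.
module Subtraction {v : ℕ} .{{_ : NonZero v}} where

  [m+n%v]%v≡[m+n]%v : ∀ m n → (m + n % v) % v ≡ (m + n) % v
  [m+n%v]%v≡[m+n]%v m n = begin
    (m + n % v) % v         ≡⟨ %-distribˡ-+ m (n % v) v ⟩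
    (m % v + n % v % v) % v ≡⟨ cong (λ r → (m % v + r) % v) (m%n%n≡m%n n v) ⟩
    (m % v + n % v) % v     ≡⟨ %-distribˡ-+ m n v ⟨
    (m + n) % v             ∎

  toℕ-⊖ : (x y : Fin v) → toℕ (x ⊖ y) ≡ (toℕ x + (v ∸ toℕ y)) % v
  toℕ-⊖ x y = toℕ-fromℕ< _

  +-⊖ : (x y : Fin v) → (toℕ y + toℕ (x ⊖ y)) % v ≡ toℕ x
  +-⊖ x y = begin
    (b + toℕ (x ⊖ y)) % v       ≡⟨ cong (λ r → (b + r) % v) (toℕ-⊖ x y) ⟩
    (b + (a + (v ∸ b)) % v) % v ≡⟨ [m+n%v]%v≡[m+n]%v b _ ⟩
    (b + (a + (v ∸ b))) % v     ≡⟨ cong (_% v) (x∙yz≈y∙xz b a (v ∸ b)) ⟩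
    (a + (b + (v ∸ b))) % v     ≡⟨ cong (λ r → (a + r) % v) (m+[n∸m]≡n (<⇒≤ (toℕ<n y))) ⟩
    (a + v) % v                 ≡⟨ [m+n]%n≡m%n a v ⟩
    a % v                       ≡⟨ m<n⇒m%n≡m (toℕ<n x) ⟩
    a                           ∎
    where a = toℕ x; b = toℕ y

  ⊖-from-+ : (x y g : Fin v) → (toℕ y + toℕ g) % v ≡ toℕ x → x ⊖ y ≡ g
  ⊖-from-+ x y g y+g≡x = toℕ-injective (begin
    toℕ (x ⊖ y)                  ≡⟨ toℕ-⊖ x y ⟩
    (toℕ x + (v ∸ b)) % v        ≡⟨ cong (λ r → (r + (v ∸ b)) % v) (sym y+g≡x) ⟩
    ((b + c) % v + (v ∸ b)) % v  ≡⟨ cong (_% v) (+-comm ((b + c) % v) (v ∸ b)) ⟩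
    ((v ∸ b) + (b + c) % v) % v  ≡⟨ [m+n%v]%v≡[m+n]%v (v ∸ b) (b + c) ⟩
    ((v ∸ b) + (b + c)) % v      ≡⟨ cong (_% v) (x∙yz≈z∙yx (v ∸ b) b c) ⟩
    (c + (b + (v ∸ b))) % v      ≡⟨ cong (λ r → (c + r) % v) (m+[n∸m]≡n (<⇒≤ (toℕ<n y))) ⟩
    (c + v) % v                  ≡⟨ [m+n]%n≡m%n c v ⟩
    c % v                        ≡⟨ m<n⇒m%n≡m (toℕ<n g) ⟩
    c                            ∎)
    where b = toℕ y; c = toℕ g

  ⊖-unique : {x y g : Fin v} → x ⊖ y ≡ g → y ≡ x ⊖ g
  ⊖-unique {x} {y} refl =
    sym (⊖-from-+ x (x ⊖ y) y (trans (cong (_% v) (+-comm (toℕ (x ⊖ y)) (toℕ y))) (+-⊖ x y)))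

  ⊖-cancel : (x g : Fin v) → x ⊖ (x ⊖ g) ≡ g
  ⊖-cancel x g = sym (⊖-unique refl)

  ⊖-self : (x : Fin v) → toℕ (x ⊖ x) ≡ 0
  ⊖-self x = trans (toℕ-⊖ x x) (trans (cong (_% v) (m+[n∸m]≡n (<⇒≤ (toℕ<n x)))) (n%n≡0 v))

  ⊖-fixed : (x g : Fin v) → x ≡ x ⊖ g → toℕ g ≡ 0
  ⊖-fixed x g x≡x⊖g = begin
    toℕ g                 ≡⟨ cong toℕ (⊖-cancel x g) ⟨
    toℕ (x ⊖ (x ⊖ g))     ≡⟨ cong (λ y → toℕ (x ⊖ y)) x≡x⊖g ⟨
    toℕ (x ⊖ x)           ≡⟨ ⊖-self x ⟩
    0                     ∎

open Subtraction

sum-tabulate-zero : ∀ {n} (f : Fin n → ℕ) → (∀ i → f i ≡ 0) → sum (List.tabulate f) ≡ 0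
sum-tabulate-zero {zero} f f≡0 = refl
sum-tabulate-zero {suc n} f f≡0 =
  cong₂ _+_ (f≡0 zero) (sum-tabulate-zero (λ i → f (suc i)) (λ i → f≡0 (suc i)))

sum-tabulate-single : ∀ {n} (f : Fin n → ℕ) (c : Fin n) → (∀ i → i ≢ c → f i ≡ 0) →
  sum (List.tabulate f) ≡ f c
sum-tabulate-single f zero off =
  trans (cong (f zero +_) (sum-tabulate-zero (λ i → f (suc i)) (λ i → off (suc i) (λ ()))))
        (+-identityʳ (f zero))
sum-tabulate-single f (suc c) off =
  cong₂ _+_ (off zero (λ ()))
            (sum-tabulate-single (λ i → f (suc i)) c (λ i i≢c → off (suc i) (λ { refl → i≢c refl })))

sum-allFin : ∀ {n} (f : Fin n → ℕ) → sum (map f (allFin n)) ≡ sum (List.tabulate f)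
sum-allFin f = cong sum (map-tabulate (λ i → i) f)

sum-allFin-single : ∀ {n} (f : Fin n → ℕ) (c : Fin n) → (∀ i → i ≢ c → f i ≡ 0) →
  sum (map f (allFin n)) ≡ f c
sum-allFin-single f c off = trans (sum-allFin f) (sum-tabulate-single f c off)

overlapSize : {v : ℕ} .{{_ : NonZero v}} → Subset v → Fin v → ℕ
overlapSize {v} X g = sum (map (λ x → 𝟙 ((x ∈ᵇ X) ∧ ((x ⊖ g) ∈ᵇ X))) (allFin v))

-- For g ≠ 0 each x ∈ X contributes to the multiplicity of g in ΔX only
-- through the pair (x, x − g), so that multiplicity is |X ∩ (X + g)|.
module DifferencesAsOverlaps {v : ℕ} .{{_ : NonZero v}}
  (X : Subset v) (g : Fin v) (g≢0 : ¬ (toℕ g ≡ 0)) where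

  pairTerm : Fin v → Fin v → ℕ
  pairTerm x y = 𝟙 ((x ∈ᵇ X) ∧ (y ∈ᵇ X) ∧ not (isYes (x Fin.≟ y)) ∧ isYes ((x ⊖ y) Fin.≟ g))

  pairTerm-off : ∀ x y → y ≢ x ⊖ g → pairTerm x y ≡ 0
  pairTerm-off x y y≢x⊖g with (x ⊖ y) Fin.≟ g
  ... | yes x⊖y≡g = ⊥-elim (y≢x⊖g (⊖-unique x⊖y≡g))
  ... | no _ = cong 𝟙 (∧-zeroʳ³ (x ∈ᵇ X) (y ∈ᵇ X) _)

  -- the pair (x, x − g) is a genuine pair (x ≠ x − g since g ≠ 0) with difference g
  pairTerm-on : ∀ x → pairTerm x (x ⊖ g) ≡ 𝟙 ((x ∈ᵇ X) ∧ ((x ⊖ g) ∈ᵇ X))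
  pairTerm-on x with x Fin.≟ (x ⊖ g) | (x ⊖ (x ⊖ g)) Fin.≟ g
  ... | yes x≡x⊖g | _ = ⊥-elim (g≢0 (⊖-fixed x g x≡x⊖g))
  ... | no _ | no x⊖[x⊖g]≢g = ⊥-elim (x⊖[x⊖g]≢g (⊖-cancel x g))
  ... | no _ | yes _ = cong (λ b → 𝟙 ((x ∈ᵇ X) ∧ b)) (∧-identityʳ _)

  diffCount≡overlapSize : diffCount X g ≡ overlapSize X g
  diffCount≡overlapSize = cong sum (map-cong (λ x →
    trans (sum-allFin-single (pairTerm x) (x ⊖ g) (pairTerm-off x)) (pairTerm-on x)) (allFin v))

open DifferencesAsOverlaps using (diffCount≡overlapSize)

-- Bit lists: a subset of ℤ_v as the list of its membership bits.
-- bitAt L a is the bit at position a (false beyond the end of L).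
bitAt : List Bool → ℕ → Bool
bitAt [] _ = false
bitAt (b ∷ L) zero = b
bitAt (b ∷ L) (suc a) = bitAt L a

bitAt-toList : ∀ {n} (X : Vec Bool n) (i : Fin n) → bitAt (toList X) (toℕ i) ≡ lookup X i
bitAt-toList (b Vec.∷ X) zero = refl
bitAt-toList (b Vec.∷ X) (suc i) = bitAt-toList X i

bitAt-++ˡ : ∀ xs ys a → a < length xs → bitAt (xs ++ ys) a ≡ bitAt xs a
bitAt-++ˡ (x ∷ xs) ys zero _ = refl
bitAt-++ˡ (x ∷ xs) ys (suc a) (s≤s a<n) = bitAt-++ˡ xs ys a a<n

bitAt-++ʳ : ∀ xs ys a → length xs ≤ a → bitAt (xs ++ ys) a ≡ bitAt ys (a ∸ length xs)
bitAt-++ʳ [] ys a _ = refl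
bitAt-++ʳ (x ∷ xs) ys (suc a) (s≤s n≤a) = bitAt-++ʳ xs ys a n≤a

bitAt-drop : ∀ k L a → bitAt (drop k L) a ≡ bitAt L (k + a)
bitAt-drop zero L a = refl
bitAt-drop (suc k) [] a = refl
bitAt-drop (suc k) (b ∷ L) a = bitAt-drop k L a

bitAt-take : ∀ k L a → a < k → bitAt (take k L) a ≡ bitAt L a
bitAt-take (suc k) [] a _ = refl
bitAt-take (suc k) (b ∷ L) zero _ = refl
bitAt-take (suc k) (b ∷ L) (suc a) (s≤s a<k) = bitAt-take k L a a<k

rotate : ℕ → List Bool → List Bool
rotate k L = drop k L ++ take k L

length-drop+k : ∀ {v} k (L : List Bool) → length L ≡ v → k ≤ v → length (drop k L) + k ≡ v
length-drop+k k L len k≤v = trans (cong (_+ k) (trans (length-drop k L) (cong (_∸ k) len))) (m∸n+n≡m k≤v)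

-- On a list of length v, rotating by k ≤ v moves the bit at (a + k) mod v to a:
-- positions a below v − k read from drop k L, the others from take k L.
rotate-bitAt : ∀ {v} .{{_ : NonZero v}} (L : List Bool) → length L ≡ v →
  ∀ {k a} → k ≤ v → a < v → bitAt (rotate k L) a ≡ bitAt L ((a + k) % v)
rotate-bitAt {v} L len {k} {a} k≤v a<v with a <? length (drop k L)
... | yes a<d = begin
  bitAt (rotate k L) a  ≡⟨ bitAt-++ˡ (drop k L) (take k L) a a<d ⟩
  bitAt (drop k L) a    ≡⟨ bitAt-drop k L a ⟩
  bitAt L (k + a)       ≡⟨ cong (bitAt L) (+-comm k a) ⟩
  bitAt L (a + k)       ≡⟨ cong (bitAt L) (m<n⇒m%n≡m a+k<v) ⟨
  bitAt L ((a + k) % v) ∎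
  where
  a+k<v : a + k < v
  a+k<v = subst (a + k <_) (length-drop+k k L len k≤v) (+-monoˡ-< k a<d)
... | no a≮d = begin
  bitAt (rotate k L) a  ≡⟨ bitAt-++ʳ (drop k L) (take k L) a d≤a ⟩
  bitAt (take k L) a′   ≡⟨ bitAt-take k L a′ a′<k ⟩
  bitAt L a′            ≡⟨ cong (bitAt L) (m<n⇒m%n≡m (<-≤-trans a′<k k≤v)) ⟨
  bitAt L (a′ % v)      ≡⟨ cong (bitAt L) ([m+n]%n≡m%n a′ v) ⟨
  bitAt L ((a′ + v) % v) ≡⟨ cong (λ r → bitAt L (r % v)) a+k≡a′+v ⟨
  bitAt L ((a + k) % v) ∎
  where
  d = length (drop k L)
  a′ = a ∸ d
  d≤a = ≮⇒≥ a≮d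
  a+k≡a′+v : a + k ≡ a′ + v
  a+k≡a′+v = begin
    a + k        ≡⟨ cong (_+ k) (m+[n∸m]≡n d≤a) ⟨
    d + a′ + k   ≡⟨ +-assoc d a′ k ⟩
    d + (a′ + k) ≡⟨ x∙yz≈y∙xz d a′ k ⟩
    a′ + (d + k) ≡⟨ cong (a′ +_) (length-drop+k k L len k≤v) ⟩
    a′ + v       ∎
  a′<k : a′ < k
  a′<k = +-cancelʳ-< v a′ k (subst₂ _<_ a+k≡a′+v (+-comm v k) (+-monoˡ-< k a<v))

commonOnes : List Bool → List Bool → ℕ
commonOnes (b ∷ L) (c ∷ R) = 𝟙 (b ∧ c) + commonOnes L R
commonOnes _ _ = 0

commonOnes-toList : ∀ {n} (X : Vec Bool n) (R : List Bool) →
  commonOnes (toList X) R ≡ sum (List.tabulate (λ i → 𝟙 (lookup X i ∧ bitAt R (toℕ i))))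
commonOnes-toList Vec.[] R = refl
commonOnes-toList (b Vec.∷ X) [] =
  sym (sum-tabulate-zero (λ i → 𝟙 (lookup (b Vec.∷ X) i ∧ false)) (λ i → cong 𝟙 (∧-zeroʳ _)))
commonOnes-toList (b Vec.∷ X) (c ∷ R) = cong (𝟙 (b ∧ c) +_) (commonOnes-toList X R)

-- |X ∩ (X + g)|, computed in linear time from the bit list of X.
rotationCount : {v : ℕ} .{{_ : NonZero v}} → Subset v → Fin v → ℕ
rotationCount {v} X g = commonOnes (toList X) (rotate (v ∸ toℕ g) (toList X))

overlapSize≡rotationCount : {v : ℕ} .{{_ : NonZero v}} (X : Subset v) (g : Fin v) →
  overlapSize X g ≡ rotationCount X g
overlapSize≡rotationCount {v} X g = begin
  sum (map term (allFin v))         ≡⟨ cong sum (map-cong bit-of-rotation (allFin v)) ⟩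
  sum (map rotatedTerm (allFin v))  ≡⟨ sum-allFin rotatedTerm ⟩
  sum (List.tabulate rotatedTerm)   ≡⟨ commonOnes-toList X R ⟨
  commonOnes (toList X) R           ∎
  where
  L = toList X
  R = rotate (v ∸ toℕ g) L
  rotatedTerm : Fin v → ℕ
  rotatedTerm x = 𝟙 (lookup X x ∧ bitAt R (toℕ x))
  term : Fin v → ℕ
  term x = 𝟙 ((x ∈ᵇ X) ∧ ((x ⊖ g) ∈ᵇ X))
  bit-of-rotation : ∀ x → term x ≡ rotatedTerm x
  bit-of-rotation x = cong (λ b → 𝟙 (lookup X x ∧ b)) (begin
    lookup X (x ⊖ g)       ≡⟨ bitAt-toList X (x ⊖ g) ⟨
    bitAt L (toℕ (x ⊖ g))  ≡⟨ cong (bitAt L) (toℕ-⊖ x g) ⟩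
    bitAt L ((toℕ x + (v ∸ toℕ g)) % v)
      ≡⟨ rotate-bitAt L (length-toList X) (m∸n≤m v (toℕ g)) (toℕ<n x) ⟨
    bitAt R (toℕ x)        ∎)

module DifferenceCondition {v : ℕ} .{{_ : NonZero v}}
  (X₁ X₂ X₃ X₄ : Subset v) (lam : ℕ) where

  Condition : (Subset v → Fin v → ℕ) → Set
  Condition count =
    (g : Fin v) → ¬ (toℕ g ≡ 0) → count X₁ g + count X₂ g + count X₃ g + count X₄ g ≡ lam

  condition? : Dec (Condition rotationCount)
  condition? = all? (λ g → ¬? (toℕ g ≟ 0) →-dec (sumOfCounts g ≟ lam))
    where
    sumOfCounts : Fin v → ℕ
    sumOfCounts g = rotationCount X₁ g + rotationCount X₂ g + rotationCount X₃ g + rotationCount X₄ g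

  by-evaluation : True condition? → Condition diffCount
  by-evaluation ok g g≢0 = trans
    (cong₂ _+_ (cong₂ _+_ (cong₂ _+_ (count-eq X₁) (count-eq X₂)) (count-eq X₃)) (count-eq X₄))
    (toWitness ok g g≢0)
    where
    count-eq : ∀ X → diffCount X g ≡ rotationCount X g
    count-eq X = trans (diffCount≡overlapSize X g g≢0) (overlapSize≡rotationCount X g)

open DifferenceCondition using (by-evaluation)

-- A GS family of shape (A, B, B, D) with A or D symmetric is propus:
-- take i = 2, j = 3 and k = 1 or k = 4.
abbd-propus : ∀ {v} .{{_ : NonZero v}} {k₁ k₂ k₃ k₄ lam} (A B D : Subset v) →
  IsGSDifferenceFamily v k₁ k₂ k₃ k₄ lam A B B D → Symmetric A ⊎ Symmetric D →
  PropusExists v k₁ k₂ k₃ k₄ lam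
abbd-propus A B D gs symmetric =
  A , B , B , D , gs , suc zero , suc (suc zero) , s≤s (s≤s z≤n) , refl , symmetric-block symmetric
  where
  symmetric-block : Symmetric A ⊎ Symmetric D →
    Σ (Fin 4) λ k → k ≢ suc zero × k ≢ suc (suc zero) × Symmetric (block A B B D k)
  symmetric-block (inj₁ sym-A) = zero , (λ ()) , (λ ()) , sym-A
  symmetric-block (inj₂ sym-D) = suc (suc (suc zero)) , (λ ()) , (λ ()) , sym-D

subset : (v : ℕ) → List ℕ → Subset v
subset v xs = Vec.tabulate (λ i → any (toℕ i ≡ᵇ_) xs)

-- Sizes and the GS condition hold by refl, the difference condition by
-- evaluation, and the last argument names the symmetric block (A or D).

propus-67-a : PropusExists 67 33 28 28 31 53
propus-67-a = abbd-propus A B D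
  ((refl , refl , refl , refl , by-evaluation A B B D 53 _) , refl) (inj₂ refl)
  where
  A : Subset 67
  A = subset 67
    (1 ∷ 2 ∷ 3 ∷ 5 ∷ 7 ∷ 8 ∷ 10 ∷ 11 ∷ 15 ∷ 19 ∷ 20 ∷ 22 ∷ 23 ∷ 27 ∷ 28 ∷ 29 ∷ 31 ∷ 32 ∷ 33 ∷
     35 ∷ 36 ∷ 37 ∷ 39 ∷ 44 ∷ 45 ∷ 46 ∷ 47 ∷ 51 ∷ 57 ∷ 58 ∷ 59 ∷ 61 ∷ 64 ∷ [])
  B : Subset 67
  B = subset 67
    (0 ∷ 1 ∷ 3 ∷ 6 ∷ 10 ∷ 16 ∷ 17 ∷ 20 ∷ 21 ∷ 22 ∷ 24 ∷ 26 ∷ 29 ∷ 32 ∷ 35 ∷ 36 ∷ 37 ∷ 39 ∷ 40 ∷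
     41 ∷ 43 ∷ 44 ∷ 45 ∷ 50 ∷ 56 ∷ 57 ∷ 59 ∷ 62 ∷ [])
  D : Subset 67
  D = subset 67
    (0 ∷ 3 ∷ 4 ∷ 5 ∷ 10 ∷ 11 ∷ 12 ∷ 13 ∷ 14 ∷ 16 ∷ 18 ∷ 20 ∷ 22 ∷ 23 ∷ 25 ∷ 32 ∷ 35 ∷ 42 ∷ 44 ∷
     45 ∷ 47 ∷ 49 ∷ 51 ∷ 53 ∷ 54 ∷ 55 ∷ 56 ∷ 57 ∷ 62 ∷ 63 ∷ 64 ∷ [])

propus-67-b : PropusExists 67 30 31 31 27 52
propus-67-b = abbd-propus A B D
  ((refl , refl , refl , refl , by-evaluation A B B D 52 _) , refl) (inj₁ refl)
  where
  A : Subset 67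
  A = subset 67
    (2 ∷ 3 ∷ 5 ∷ 6 ∷ 7 ∷ 9 ∷ 11 ∷ 12 ∷ 13 ∷ 16 ∷ 20 ∷ 21 ∷ 23 ∷ 25 ∷ 27 ∷ 40 ∷ 42 ∷ 44 ∷ 46 ∷
     47 ∷ 51 ∷ 54 ∷ 55 ∷ 56 ∷ 58 ∷ 60 ∷ 61 ∷ 62 ∷ 64 ∷ 65 ∷ [])
  B : Subset 67
  B = subset 67
    (0 ∷ 1 ∷ 2 ∷ 3 ∷ 7 ∷ 10 ∷ 12 ∷ 13 ∷ 16 ∷ 20 ∷ 22 ∷ 27 ∷ 29 ∷ 30 ∷ 32 ∷ 35 ∷ 37 ∷ 38 ∷ 41 ∷
     42 ∷ 43 ∷ 44 ∷ 45 ∷ 46 ∷ 50 ∷ 56 ∷ 57 ∷ 58 ∷ 61 ∷ 62 ∷ 66 ∷ [])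
  D : Subset 67
  D = subset 67
    (5 ∷ 6 ∷ 11 ∷ 12 ∷ 13 ∷ 15 ∷ 16 ∷ 18 ∷ 19 ∷ 21 ∷ 23 ∷ 27 ∷ 33 ∷ 36 ∷ 39 ∷ 40 ∷ 42 ∷ 46 ∷
     47 ∷ 51 ∷ 53 ∷ 56 ∷ 59 ∷ 61 ∷ 62 ∷ 63 ∷ 64 ∷ [])

propus-67-c : PropusExists 67 30 30 30 28 51
propus-67-c = abbd-propus A B D
  ((refl , refl , refl , refl , by-evaluation A B B D 51 _) , refl) (inj₁ refl)
  where
  A : Subset 67
  A = subset 67
    (2 ∷ 4 ∷ 7 ∷ 9 ∷ 12 ∷ 13 ∷ 14 ∷ 15 ∷ 17 ∷ 18 ∷ 19 ∷ 24 ∷ 25 ∷ 26 ∷ 33 ∷ 34 ∷ 41 ∷ 42 ∷ 43 ∷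
     48 ∷ 49 ∷ 50 ∷ 52 ∷ 53 ∷ 54 ∷ 55 ∷ 58 ∷ 60 ∷ 63 ∷ 65 ∷ [])
  B : Subset 67
  B = subset 67
    (1 ∷ 2 ∷ 5 ∷ 7 ∷ 11 ∷ 15 ∷ 16 ∷ 18 ∷ 19 ∷ 25 ∷ 29 ∷ 30 ∷ 33 ∷ 36 ∷ 37 ∷ 38 ∷ 39 ∷ 41 ∷ 43 ∷
     50 ∷ 51 ∷ 53 ∷ 54 ∷ 55 ∷ 56 ∷ 58 ∷ 59 ∷ 62 ∷ 63 ∷ 66 ∷ [])
  D : Subset 67
  D = subset 67
    (0 ∷ 1 ∷ 2 ∷ 7 ∷ 8 ∷ 9 ∷ 16 ∷ 18 ∷ 25 ∷ 28 ∷ 29 ∷ 31 ∷ 34 ∷ 37 ∷ 41 ∷ 43 ∷ 48 ∷ 50 ∷ 52 ∷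
     53 ∷ 54 ∷ 55 ∷ 56 ∷ 58 ∷ 60 ∷ 62 ∷ 63 ∷ 65 ∷ [])

propus-103 : PropusExists 103 48 51 51 42 89
propus-103 = abbd-propus A B D
  ((refl , refl , refl , refl , by-evaluation A B B D 89 _) , refl) (inj₁ refl)
  where
  A : Subset 103
  A = subset 103
    (2 ∷ 5 ∷ 7 ∷ 9 ∷ 11 ∷ 13 ∷ 14 ∷ 15 ∷ 16 ∷ 19 ∷ 20 ∷ 21 ∷ 23 ∷ 24 ∷ 26 ∷ 28 ∷ 29 ∷ 31 ∷ 34 ∷
     39 ∷ 40 ∷ 43 ∷ 50 ∷ 51 ∷ 52 ∷ 53 ∷ 60 ∷ 63 ∷ 64 ∷ 69 ∷ 72 ∷ 74 ∷ 75 ∷ 77 ∷ 79 ∷ 80 ∷ 82 ∷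
     83 ∷ 84 ∷ 87 ∷ 88 ∷ 89 ∷ 90 ∷ 92 ∷ 94 ∷ 96 ∷ 98 ∷ 101 ∷ [])
  B : Subset 103
  B = subset 103
    (1 ∷ 2 ∷ 3 ∷ 4 ∷ 7 ∷ 8 ∷ 9 ∷ 10 ∷ 11 ∷ 13 ∷ 17 ∷ 18 ∷ 19 ∷ 21 ∷ 22 ∷ 23 ∷ 25 ∷ 28 ∷ 29 ∷
     31 ∷ 34 ∷ 35 ∷ 36 ∷ 39 ∷ 43 ∷ 45 ∷ 46 ∷ 48 ∷ 50 ∷ 52 ∷ 53 ∷ 56 ∷ 59 ∷ 60 ∷ 61 ∷ 64 ∷ 65 ∷
     69 ∷ 79 ∷ 81 ∷ 82 ∷ 83 ∷ 84 ∷ 85 ∷ 87 ∷ 88 ∷ 92 ∷ 94 ∷ 98 ∷ 99 ∷ 101 ∷ [])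
  D : Subset 103
  D = subset 103
    (2 ∷ 5 ∷ 6 ∷ 8 ∷ 9 ∷ 10 ∷ 11 ∷ 12 ∷ 17 ∷ 24 ∷ 25 ∷ 27 ∷ 36 ∷ 37 ∷ 38 ∷ 40 ∷ 42 ∷ 45 ∷ 47 ∷
     48 ∷ 53 ∷ 54 ∷ 55 ∷ 57 ∷ 58 ∷ 59 ∷ 61 ∷ 68 ∷ 69 ∷ 70 ∷ 74 ∷ 77 ∷ 78 ∷ 84 ∷ 86 ∷ 89 ∷ 92 ∷
     93 ∷ 94 ∷ 100 ∷ 101 ∷ 102 ∷ [])

propus-109 : PropusExists 109 52 49 49 48 89
propus-109 = abbd-propus A B D
  ((refl , refl , refl , refl , by-evaluation A B B D 89 _) , refl) (inj₂ refl)
  where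
  A : Subset 109
  A = subset 109
    (0 ∷ 2 ∷ 5 ∷ 6 ∷ 7 ∷ 8 ∷ 10 ∷ 11 ∷ 12 ∷ 14 ∷ 16 ∷ 17 ∷ 20 ∷ 24 ∷ 27 ∷ 28 ∷ 33 ∷ 38 ∷ 39 ∷
     46 ∷ 48 ∷ 51 ∷ 52 ∷ 53 ∷ 59 ∷ 60 ∷ 61 ∷ 62 ∷ 64 ∷ 65 ∷ 66 ∷ 67 ∷ 68 ∷ 69 ∷ 72 ∷ 74 ∷ 75 ∷
     79 ∷ 81 ∷ 84 ∷ 85 ∷ 89 ∷ 90 ∷ 91 ∷ 95 ∷ 96 ∷ 97 ∷ 99 ∷ 102 ∷ 104 ∷ 105 ∷ 108 ∷ [])
  B : Subset 109
  B = subset 109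
    (0 ∷ 1 ∷ 4 ∷ 11 ∷ 12 ∷ 13 ∷ 15 ∷ 20 ∷ 21 ∷ 28 ∷ 30 ∷ 34 ∷ 37 ∷ 38 ∷ 39 ∷ 40 ∷ 41 ∷ 42 ∷ 43 ∷
     45 ∷ 46 ∷ 50 ∷ 53 ∷ 55 ∷ 56 ∷ 59 ∷ 60 ∷ 61 ∷ 63 ∷ 64 ∷ 69 ∷ 70 ∷ 71 ∷ 73 ∷ 74 ∷ 75 ∷ 76 ∷
     77 ∷ 82 ∷ 84 ∷ 86 ∷ 93 ∷ 96 ∷ 98 ∷ 101 ∷ 102 ∷ 104 ∷ 105 ∷ 108 ∷ [])
  D : Subset 109
  D = subset 109
    (1 ∷ 5 ∷ 7 ∷ 9 ∷ 11 ∷ 12 ∷ 20 ∷ 22 ∷ 23 ∷ 25 ∷ 28 ∷ 30 ∷ 31 ∷ 32 ∷ 35 ∷ 37 ∷ 39 ∷ 42 ∷ 45 ∷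
     46 ∷ 48 ∷ 49 ∷ 50 ∷ 54 ∷ 55 ∷ 59 ∷ 60 ∷ 61 ∷ 63 ∷ 64 ∷ 67 ∷ 70 ∷ 72 ∷ 74 ∷ 77 ∷ 78 ∷ 79 ∷
     81 ∷ 84 ∷ 86 ∷ 87 ∷ 89 ∷ 97 ∷ 98 ∷ 100 ∷ 102 ∷ 104 ∷ 108 ∷ [])

propus-151 : PropusExists 151 71 71 71 66 128
propus-151 = abbd-propus A B D
  ((refl , refl , refl , refl , by-evaluation A B B D 128 _) , refl) (inj₁ refl)
  where
  A : Subset 151
  A = subset 151
    (0 ∷ 3 ∷ 4 ∷ 6 ∷ 10 ∷ 12 ∷ 13 ∷ 14 ∷ 22 ∷ 24 ∷ 25 ∷ 26 ∷ 30 ∷ 32 ∷ 34 ∷ 35 ∷ 36 ∷ 37 ∷ 39 ∷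
     41 ∷ 42 ∷ 43 ∷ 46 ∷ 47 ∷ 48 ∷ 49 ∷ 52 ∷ 55 ∷ 57 ∷ 61 ∷ 62 ∷ 66 ∷ 69 ∷ 71 ∷ 74 ∷ 75 ∷ 76 ∷
     77 ∷ 80 ∷ 82 ∷ 85 ∷ 89 ∷ 90 ∷ 94 ∷ 96 ∷ 99 ∷ 102 ∷ 103 ∷ 104 ∷ 105 ∷ 108 ∷ 109 ∷ 110 ∷
     112 ∷ 114 ∷ 115 ∷ 116 ∷ 117 ∷ 119 ∷ 121 ∷ 125 ∷ 126 ∷ 127 ∷ 129 ∷ 137 ∷ 138 ∷ 139 ∷ 141 ∷
     145 ∷ 147 ∷ 148 ∷ [])
  B : Subset 151
  B = subset 151
    (0 ∷ 1 ∷ 2 ∷ 3 ∷ 6 ∷ 8 ∷ 10 ∷ 11 ∷ 12 ∷ 13 ∷ 15 ∷ 16 ∷ 17 ∷ 19 ∷ 21 ∷ 24 ∷ 26 ∷ 27 ∷ 30 ∷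
     31 ∷ 34 ∷ 36 ∷ 37 ∷ 38 ∷ 39 ∷ 41 ∷ 42 ∷ 43 ∷ 45 ∷ 48 ∷ 52 ∷ 53 ∷ 54 ∷ 57 ∷ 58 ∷ 59 ∷ 60 ∷
     62 ∷ 64 ∷ 65 ∷ 67 ∷ 69 ∷ 70 ∷ 77 ∷ 80 ∷ 82 ∷ 83 ∷ 88 ∷ 89 ∷ 96 ∷ 97 ∷ 99 ∷ 100 ∷ 101 ∷
     103 ∷ 104 ∷ 107 ∷ 108 ∷ 109 ∷ 114 ∷ 117 ∷ 118 ∷ 120 ∷ 121 ∷ 122 ∷ 128 ∷ 130 ∷ 134 ∷ 136 ∷
     137 ∷ 145 ∷ [])
  D : Subset 151
  D = subset 151
    (0 ∷ 3 ∷ 4 ∷ 6 ∷ 7 ∷ 10 ∷ 11 ∷ 15 ∷ 24 ∷ 26 ∷ 27 ∷ 30 ∷ 32 ∷ 36 ∷ 39 ∷ 41 ∷ 45 ∷ 46 ∷ 48 ∷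
     52 ∷ 53 ∷ 54 ∷ 56 ∷ 57 ∷ 58 ∷ 60 ∷ 65 ∷ 66 ∷ 67 ∷ 68 ∷ 70 ∷ 75 ∷ 76 ∷ 80 ∷ 82 ∷ 83 ∷ 84 ∷
     85 ∷ 86 ∷ 87 ∷ 88 ∷ 89 ∷ 91 ∷ 92 ∷ 100 ∷ 101 ∷ 105 ∷ 107 ∷ 108 ∷ 109 ∷ 111 ∷ 114 ∷ 117 ∷
     119 ∷ 120 ∷ 122 ∷ 124 ∷ 130 ∷ 132 ∷ 133 ∷ 134 ∷ 137 ∷ 143 ∷ 146 ∷ 147 ∷ 150 ∷ [])

mainTheorem2 :
    PropusExists 67 33 28 28 31 53 ×
    PropusExists 67 30 31 31 27 52 ×
    PropusExists 67 30 30 30 28 51 ×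
    PropusExists 103 48 51 51 42 89 ×
    PropusExists 109 52 49 49 48 89 ×
    PropusExists 151 71 71 71 66 128
mainTheorem2 = propus-67-a , propus-67-b , propus-67-c , propus-103 , propus-109 , propus-151
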